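{- Let $H=(V,E)$ be a hypergraph without empty edges, and $G=\mathcal{G}(H)$ its incidence graph. (1) For any $e\in E$: $e$ is a cut edge of $H$ if and only if $e$ is a cut vertex of $G$. (2) Let $|V|\ge 2$ and let $v\in V$ be such that $\{v\}\notin E$ (no edge has vertex set $\{v\}$). Then $v$ is a cut vertex of $H$ if and only if $v$ is a cut vertex of $G$.
   Context: A hypergraph $H=(V,E)$ consists of a nonempty finite vertex set $V$, a finite edge set $E$, and an incidence function $\psi:E\to 2^V$; edges are identified with their vertex sets (parallel edges allowed), and an edge with empty vertex set is an empty edge. Two distinct vertices are adjacent via $e$ if both lie in $e$; a walk is a sequence $v_0e_1v_1\dots e_kv_k$ with $v_{i-1},v_i$ adjacent via $e_i$. For an equivalence class $V'$ of "joined by a walk", the connected component is $(V',\{f\in E:\emptyset\ne f\subseteq V'\})$; $\omega(H)$ is the number of components. $H-e=(V,E\setminus\{e\})$; $e$ is a cut edge if $\omega(H-e)>\omega(H)$. For $|V|\ge2$ and $v\in V$, $H\backslash v$ has vertex set $V\setminus\{v\}$ and edges $e\setminus\{v\}$ for all $e\in E$ with $e\setminus\{v\}\ne\emptyset$; $v$ is a cut vertex of $H$ if $\omega(H\backslash v)>\omega(H)$. The incidence graph $\mathcal{G}(H)$ is the bipartite graph with vertex set $V\cup E$ and edge set $\{ve: v\in e\}$; a cut vertex of a graph $G$ is a vertex $x$ with $\omega(G- x)>\omega(G)$, where $\omega$ counts connected components. -}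

module Defs where

open import Data.Nat using (ℕ; _<_)
open import Data.Fin using (Fin)
open import Data.Fin.Subset using (Subset; _∈_)
open import Data.Product using (Σ; ∃; ∃-syntax; _×_; _,_; proj₁)
open import Data.Sum using (_⊎_; inj₁; inj₂)
open import Data.Empty using (⊥)
open import Relation.Nullary using (¬_)
open import Relation.Binary.PropositionalEquality using (_≡_; _≢_)
open import Relation.Binary.Construct.Closure.ReflexiveTransitive using (Star)
open import Function.Bundles using (_⇔_)

-- Given a one-step relation R on a type A, the classes of the
-- reflexive-transitive closure (Star R) are the components.
-- `NumComponents R k` says there are exactly k classes: there is a
-- surjective labelling c : A → Fin k whose fibres are exactly the classes.

NumComponents : {A : Set} → (A → A → Set) → ℕ → Set
NumComponents {A} R k =
  Σ (A → Fin k) λ c →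
    (∀ (i : Fin k) → ∃[ a ] c a ≡ i) ×
    (∀ (a b : A) → (c a ≡ c b) ⇔ Star R a b)

record Hypergraph : Set₁ where
  field
    V   : Set
    E   : Set
    _∈ₑ_ : V → E → Set

open Hypergraph

HAdj : (H : Hypergraph) → V H → V H → Set
HAdj H u w = u ≢ w × ∃[ e ] (_∈ₑ_ H u e × _∈ₑ_ H w e)

ωH : Hypergraph → ℕ → Set
ωH H k = NumComponents (HAdj H) k

_-ₑ_ : (H : Hypergraph) → E H → Hypergraph
H -ₑ e = record
  { V = V H
  ; E = Σ (E H) (λ f → f ≢ e)
  ; _∈ₑ_ = λ u f → _∈ₑ_ H u (proj₁ f)
  }

-- H \ v : vertices V ∖ {v}, edges f ∖ {v} for those f with f ∖ {v} ≠ ∅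
_∖ᵥ_ : (H : Hypergraph) → V H → Hypergraph
H ∖ᵥ v = record
  { V = Σ (V H) (λ u → u ≢ v)
  ; E = Σ (E H) (λ f → ∃[ u ] (u ≢ v × _∈ₑ_ H u f))
  ; _∈ₑ_ = λ u f → _∈ₑ_ H (proj₁ u) (proj₁ f)
  }

IsCutEdge : (H : Hypergraph) → E H → Set
IsCutEdge H e = ∃[ k ] ∃[ k' ] (ωH H k × ωH (H -ₑ e) k' × k < k')

IsCutVertexH : (H : Hypergraph) → V H → Set
IsCutVertexH H v = ∃[ k ] ∃[ k' ] (ωH H k × ωH (H ∖ᵥ v) k' × k < k')

record Graph : Set₁ where
  field
    W   : Set
    Adj : W → W → Set

open Graph

ωG : Graph → ℕ → Set
ωG G k = NumComponents (Adj G) k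

_-ᵥ_ : (G : Graph) → W G → Graph
G -ᵥ x = record
  { W = Σ (W G) (λ y → y ≢ x)
  ; Adj = λ a b → Adj G (proj₁ a) (proj₁ b)
  }

IsCutVertexG : (G : Graph) → W G → Set
IsCutVertexG G x = ∃[ k ] ∃[ k' ] (ωG G k × ωG (G -ᵥ x) k' × k < k')

hyp : (n m : ℕ) → (Fin m → Subset n) → Hypergraph
hyp n m ψ = record { V = Fin n ; E = Fin m ; _∈ₑ_ = λ v e → v ∈ ψ e }

incAdj : (n m : ℕ) → (Fin m → Subset n) → Fin n ⊎ Fin m → Fin n ⊎ Fin m → Set
incAdj n m ψ (inj₁ v) (inj₂ e) = v ∈ ψ e
incAdj n m ψ (inj₂ e) (inj₁ v) = v ∈ ψ e
incAdj n m ψ (inj₁ _) (inj₁ _) = ⊥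
incAdj n m ψ (inj₂ _) (inj₂ _) = ⊥

incidenceGraph : (n m : ℕ) → (Fin m → Subset n) → Graph
incidenceGraph n m ψ = record { W = Fin n ⊎ Fin m ; Adj = incAdj n m ψ }

-- Sending a vertex of H to itself and an edge to one of its vertices (there is one, as edges
-- are nonempty) identifies the walk-components of H with those of its incidence graph 𝒢(H).
-- Deleting the node e of 𝒢(H) gives exactly 𝒢(H - e), and deleting the node v gives 𝒢(H \ v)
-- up to relabelling edges f by f ∖ {v}; that relabelling needs every f ∖ {v} to be nonempty,
-- which is where {v} ∉ E enters. So both sides of (1) and of (2) compare the same numbers.
module Submission where

open import Defs
open import Data.Nat using (ℕ; _≤_; _<_)
open import Data.Fin using (Fin; _≟_)
open import Data.Fin.Subset using (Subset; Nonempty; ⁅_⁆; _∈_)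
open import Data.Fin.Subset.Properties using (⊆-antisym; x∈⁅y⁆⇔x≡y; _∈?_)
open import Data.Fin.Properties using (any?)
open import Data.Product using (∃-syntax; _×_; _,_; proj₁; proj₂)
open import Data.Product.Properties using (≡-dec)
open import Data.Sum using (_⊎_; inj₁; inj₂)
open import Data.Sum.Properties using (inj₁-injective; inj₂-injective)
open import Data.Empty using (⊥-elim)
open import Relation.Nullary using (yes; no)
open import Relation.Nullary.Decidable using (¬?; _×-dec_; decidable-stable)
open import Relation.Binary.Definitions using (Symmetric; DecidableEquality)
open import Relation.Binary.PropositionalEquality using (_≡_; _≢_; refl; sym; trans; cong; subst)
open import Relation.Binary.Construct.Closure.ReflexiveTransitive
  using (Star; ε; _◅_; _◅◅_; return; reverse; kleisliStar)
open import Function.Base using (_∘_)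
open import Function.Bundles using (_⇔_; mk⇔; Equivalence)
open import Function.Properties.Equivalence using () renaming (trans to ⇔-trans)

open Hypergraph
open Graph

record _≈ᶜ_ {A B : Set} (R : A → A → Set) (S : B → B → Set) : Set where
  field
    to        : A → B
    from      : B → A
    to-step   : ∀ {a a'} → R a a' → Star S (to a) (to a')
    from-step : ∀ {b b'} → S b b' → Star R (from b) (from b')
    from-to   : ∀ a → Star R (from (to a)) a
    to-from   : ∀ b → Star S (to (from b)) b

≈ᶜ-sym : {A B : Set} {R : A → A → Set} {S : B → B → Set} → R ≈ᶜ S → S ≈ᶜ R
≈ᶜ-sym c = record
  { to = from ; from = to ; to-step = from-step ; from-step = to-step
  ; from-to = to-from ; to-from = from-to }
  where open _≈ᶜ_ c

NumComponents-transport : {A B : Set} {R : A → A → Set} {S : B → B → Set} {k : ℕ} →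
  R ≈ᶜ S → Symmetric S → NumComponents R k → NumComponents S k
NumComponents-transport {R = R} {S} c S-sym (label , label-onto , label-fibres) =
  label ∘ from , onto , fibres
  where
  open _≈ᶜ_ c
  onto : ∀ i → ∃[ b ] label (from b) ≡ i
  onto i with label-onto i
  ... | a , refl = to a , Equivalence.from (label-fibres (from (to a)) a) (from-to a)
  fibres : ∀ b b' → (label (from b) ≡ label (from b')) ⇔ Star S b b'
  fibres b b' = mk⇔
    (λ same → reverse S-sym (to-from b)
              ◅◅ kleisliStar to to-step (Equivalence.to (label-fibres (from b) (from b')) same)
              ◅◅ to-from b')
    (λ walk → Equivalence.from (label-fibres (from b) (from b')) (kleisliStar from from-step walk))

NumComponents-cong : {A B : Set} {R : A → A → Set} {S : B → B → Set} {k : ℕ} →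
  R ≈ᶜ S → Symmetric R → Symmetric S → NumComponents R k ⇔ NumComponents S k
NumComponents-cong c R-sym S-sym =
  mk⇔ (NumComponents-transport c S-sym) (NumComponents-transport (≈ᶜ-sym c) R-sym)

Increases : (ℕ → Set) → (ℕ → Set) → Set
Increases P Q = ∃[ k ] ∃[ k' ] (P k × Q k' × k < k')

Increases-cong : {P P' Q Q' : ℕ → Set} →
  (∀ {k} → P k ⇔ P' k) → (∀ {k} → Q k ⇔ Q' k) → Increases P Q ⇔ Increases P' Q'
Increases-cong P⇔P' Q⇔Q' = mk⇔
  (λ (k , k' , p , q , k<k') → k , k' , Equivalence.to P⇔P' p , Equivalence.to Q⇔Q' q , k<k')
  (λ (k , k' , p , q , k<k') → k , k' , Equivalence.from P⇔P' p , Equivalence.from Q⇔Q' q , k<k')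

HAdj-sym : (H : Hypergraph) → Symmetric (HAdj H)
HAdj-sym H (u≢w , e , u∈e , w∈e) = (λ w≡u → u≢w (sym w≡u)) , e , w∈e , u∈e

walk-within-edge : (H : Hypergraph) → DecidableEquality (V H) →
  ∀ {u w} e → _∈ₑ_ H u e → _∈ₑ_ H w e → Star (HAdj H) u w
walk-within-edge H _≟ᵥ_ {u} {w} e u∈e w∈e with u ≟ᵥ w
... | yes refl = ε
... | no u≢w   = return (u≢w , e , u∈e , w∈e)

data IncAdj (H : Hypergraph) : V H ⊎ E H → V H ⊎ E H → Set where
  vertex-edge : ∀ {u e} → _∈ₑ_ H u e → IncAdj H (inj₁ u) (inj₂ e)
  edge-vertex : ∀ {u e} → _∈ₑ_ H u e → IncAdj H (inj₂ e) (inj₁ u)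

IncAdj-sym : (H : Hypergraph) → Symmetric (IncAdj H)
IncAdj-sym H (vertex-edge u∈e) = edge-vertex u∈e
IncAdj-sym H (edge-vertex u∈e) = vertex-edge u∈e

HAdj≈ᶜIncAdj : (H : Hypergraph) → DecidableEquality (V H) → (∀ e → ∃[ u ] _∈ₑ_ H u e) →
  HAdj H ≈ᶜ IncAdj H
HAdj≈ᶜIncAdj H _≟ᵥ_ member = record
  { to = inj₁ ; from = from ; to-step = to-step ; from-step = from-step
  ; from-to = λ _ → ε ; to-from = to-from }
  where
  from : V H ⊎ E H → V H
  from (inj₁ u) = u
  from (inj₂ e) = proj₁ (member e)
  to-step : ∀ {u w} → HAdj H u w → Star (IncAdj H) (inj₁ u) (inj₁ w)
  to-step (_ , e , u∈e , w∈e) = vertex-edge u∈e ◅ edge-vertex w∈e ◅ ε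
  from-step : ∀ {x y} → IncAdj H x y → Star (HAdj H) (from x) (from y)
  from-step (vertex-edge {e = e} u∈e) = walk-within-edge H _≟ᵥ_ e u∈e (proj₂ (member e))
  from-step (edge-vertex {e = e} u∈e) = walk-within-edge H _≟ᵥ_ e (proj₂ (member e)) u∈e
  to-from : ∀ x → Star (IncAdj H) (inj₁ (from x)) x
  to-from (inj₁ _) = ε
  to-from (inj₂ e) = return (vertex-edge (proj₂ (member e)))

ωH⇔incidenceComponents : (H : Hypergraph) → DecidableEquality (V H) → (∀ e → ∃[ u ] _∈ₑ_ H u e) →
  ∀ {k} → ωH H k ⇔ NumComponents (IncAdj H) k
ωH⇔incidenceComponents H _≟ᵥ_ member =
  NumComponents-cong (HAdj≈ᶜIncAdj H _≟ᵥ_ member) (HAdj-sym H) (IncAdj-sym H)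

∃-other-member : ∀ {n} {p : Subset n} {v : Fin n} →
  Nonempty p → p ≢ ⁅ v ⁆ → ∃[ u ] (u ≢ v × u ∈ p)
∃-other-member {p = p} {v} (w , w∈p) p≢⁅v⁆ with any? (λ u → ¬? (u ≟ v) ×-dec (u ∈? p))
... | yes other = other
... | no  none  = ⊥-elim (p≢⁅v⁆ (⊆-antisym p⊆⁅v⁆ ⁅v⁆⊆p))
  where
  only-v : ∀ {u} → u ∈ p → u ≡ v
  only-v {u} u∈p = decidable-stable (u ≟ v) (λ u≢v → none (u , u≢v , u∈p))
  p⊆⁅v⁆ : ∀ {u} → u ∈ p → u ∈ ⁅ v ⁆
  p⊆⁅v⁆ u∈p = Equivalence.from x∈⁅y⁆⇔x≡y (only-v u∈p)
  ⁅v⁆⊆p : ∀ {u} → u ∈ ⁅ v ⁆ → u ∈ p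
  ⁅v⁆⊆p u∈⁅v⁆ = subst (_∈ p) (trans (only-v w∈p) (sym (Equivalence.to x∈⁅y⁆⇔x≡y u∈⁅v⁆))) w∈p

module _ (n m : ℕ) (ψ : Fin m → Subset n) where

  private
    H : Hypergraph
    H = hyp n m ψ
    G : Graph
    G = incidenceGraph n m ψ

  incAdj-sym : Symmetric (incAdj n m ψ)
  incAdj-sym {inj₁ _} {inj₂ _} u∈e = u∈e
  incAdj-sym {inj₂ _} {inj₁ _} u∈e = u∈e

  -- Proofs of _≢_ are definitionally equal (⊥ is irrelevant): the relabellings below are
  -- mutually inverse on the nose, and subtypes Σ A (_≢ a) inherit decidable equality.
  IncAdj≈ᶜincAdj : IncAdj H ≈ᶜ incAdj n m ψ
  IncAdj≈ᶜincAdj = record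
    { to = λ x → x ; from = λ x → x
    ; to-step = return ∘ to-step
    ; from-step = λ {x} {y} → return ∘ from-step {x} {y}
    ; from-to = λ _ → ε ; to-from = λ _ → ε }
    where
    to-step : ∀ {x y} → IncAdj H x y → incAdj n m ψ x y
    to-step (vertex-edge u∈e) = u∈e
    to-step (edge-vertex u∈e) = u∈e
    from-step : ∀ {x y} → incAdj n m ψ x y → IncAdj H x y
    from-step {inj₁ _} {inj₂ _} = vertex-edge
    from-step {inj₂ _} {inj₁ _} = edge-vertex

  IncAdj-ₑ≈ᶜAdj-ᵥ : ∀ e → IncAdj (H -ₑ e) ≈ᶜ Adj (G -ᵥ inj₂ e)
  IncAdj-ₑ≈ᶜAdj-ᵥ e = record
    { to = to ; from = from
    ; to-step = return ∘ to-step
    ; from-step = λ {x} {y} → return ∘ from-step {x} {y}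
    ; from-to = λ { (inj₁ _) → ε ; (inj₂ _) → ε }
    ; to-from = λ { (inj₁ _ , _) → ε ; (inj₂ _ , _) → ε } }
    where
    to : V (H -ₑ e) ⊎ E (H -ₑ e) → W (G -ᵥ inj₂ e)
    to (inj₁ u) = inj₁ u , λ ()
    to (inj₂ (f , f≢e)) = inj₂ f , f≢e ∘ inj₂-injective
    from : W (G -ᵥ inj₂ e) → V (H -ₑ e) ⊎ E (H -ₑ e)
    from (inj₁ u , _) = inj₁ u
    from (inj₂ f , f≢e) = inj₂ (f , f≢e ∘ cong inj₂)
    to-step : ∀ {x y} → IncAdj (H -ₑ e) x y → Adj (G -ᵥ inj₂ e) (to x) (to y)
    to-step (vertex-edge u∈f) = u∈f
    to-step (edge-vertex u∈f) = u∈f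
    from-step : ∀ {x y} → Adj (G -ᵥ inj₂ e) x y → IncAdj (H -ₑ e) (from x) (from y)
    from-step {inj₁ _ , _} {inj₂ _ , _} = vertex-edge
    from-step {inj₂ _ , _} {inj₁ _ , _} = edge-vertex

  IncAdj∖ᵥ≈ᶜAdj-ᵥ : ∀ v → (∀ f → ∃[ u ] (u ≢ v × u ∈ ψ f)) →
    IncAdj (H ∖ᵥ v) ≈ᶜ Adj (G -ᵥ inj₁ v)
  IncAdj∖ᵥ≈ᶜAdj-ᵥ v other = record
    { to = to ; from = from
    ; to-step = return ∘ to-step
    ; from-step = λ {x} {y} → return ∘ from-step {x} {y}
    ; from-to = from-to
    ; to-from = λ { (inj₁ _ , _) → ε ; (inj₂ _ , _) → ε } }
    where
    to : V (H ∖ᵥ v) ⊎ E (H ∖ᵥ v) → W (G -ᵥ inj₁ v)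
    to (inj₁ (u , u≢v)) = inj₁ u , u≢v ∘ inj₁-injective
    to (inj₂ (f , _)) = inj₂ f , λ ()
    from : W (G -ᵥ inj₁ v) → V (H ∖ᵥ v) ⊎ E (H ∖ᵥ v)
    from (inj₁ u , u≢v) = inj₁ (u , u≢v ∘ cong inj₁)
    from (inj₂ f , _) = inj₂ (f , other f)
    to-step : ∀ {x y} → IncAdj (H ∖ᵥ v) x y → Adj (G -ᵥ inj₁ v) (to x) (to y)
    to-step (vertex-edge u∈f) = u∈f
    to-step (edge-vertex u∈f) = u∈f
    from-step : ∀ {x y} → Adj (G -ᵥ inj₁ v) x y → IncAdj (H ∖ᵥ v) (from x) (from y)
    from-step {inj₁ _ , _} {inj₂ _ , _} = vertex-edge
    from-step {inj₂ _ , _} {inj₁ _ , _} = edge-vertex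
    -- An edge of H \ v carries a witness of f ∖ {v} that may differ from the chosen one;
    -- the two copies of f are joined through the witness vertex.
    from-to : ∀ x → Star (IncAdj (H ∖ᵥ v)) (from (to x)) x
    from-to (inj₁ _) = ε
    from-to (inj₂ (f , u , u≢v , u∈f)) = edge-vertex {u = u , u≢v} u∈f ◅ vertex-edge u∈f ◅ ε

  module _ (nonempty : ∀ e → Nonempty (ψ e)) where

    ωH⇔ωG : ∀ {k} → ωH H k ⇔ ωG G k
    ωH⇔ωG = ⇔-trans (ωH⇔incidenceComponents H _≟_ nonempty)
      (NumComponents-cong IncAdj≈ᶜincAdj (IncAdj-sym H) incAdj-sym)

    ωH-ₑ⇔ωG-ᵥ : ∀ e {k} → ωH (H -ₑ e) k ⇔ ωG (G -ᵥ inj₂ e) k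
    ωH-ₑ⇔ωG-ᵥ e = ⇔-trans
      (ωH⇔incidenceComponents (H -ₑ e) _≟_ (λ (f , _) → nonempty f))
      (NumComponents-cong (IncAdj-ₑ≈ᶜAdj-ᵥ e)
        (IncAdj-sym (H -ₑ e)) (λ {a b} → incAdj-sym {proj₁ a} {proj₁ b}))

    ωH∖ᵥ⇔ωG-ᵥ : ∀ v → (∀ e → ψ e ≢ ⁅ v ⁆) → ∀ {k} → ωH (H ∖ᵥ v) k ⇔ ωG (G -ᵥ inj₁ v) k
    ωH∖ᵥ⇔ωG-ᵥ v no-singleton = ⇔-trans
      (ωH⇔incidenceComponents (H ∖ᵥ v) (≡-dec _≟_ (λ _ _ → yes refl))
        (λ (_ , u , u≢v , u∈f) → (u , u≢v) , u∈f))
      (NumComponents-cong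
        (IncAdj∖ᵥ≈ᶜAdj-ᵥ v (λ f → ∃-other-member (nonempty f) (no-singleton f)))
        (IncAdj-sym (H ∖ᵥ v)) (λ {a b} → incAdj-sym {proj₁ a} {proj₁ b}))

theorem3p24 : (n m : ℕ) (ψ : Fin m → Subset n) →
    1 ≤ n →
    (∀ (e : Fin m) → Nonempty (ψ e)) →
    (∀ (e : Fin m) →
      IsCutEdge (hyp n m ψ) e ⇔ IsCutVertexG (incidenceGraph n m ψ) (inj₂ e))
    ×
    (2 ≤ n → ∀ (v : Fin n) → (∀ (e : Fin m) → ψ e ≢ ⁅ v ⁆) →
      IsCutVertexH (hyp n m ψ) v ⇔ IsCutVertexG (incidenceGraph n m ψ) (inj₁ v))
theorem3p24 n m ψ _ nonempty =
  (λ e → Increases-cong (ωH⇔ωG n m ψ nonempty) (ωH-ₑ⇔ωG-ᵥ n m ψ nonempty e)) ,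
  (λ _ v no-singleton →
    Increases-cong (ωH⇔ωG n m ψ nonempty) (ωH∖ᵥ⇔ωG-ᵥ n m ψ nonempty v no-singleton))
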